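{- If $G$ is a non-trivial cograph (i.e., a cograph with at least two vertices), then $\mu^{ - }(G)\le \Delta(G)+1$.
   Context: All graphs are simple and undirected. A cograph is a graph containing no induced path on four vertices; $\Delta(G)$ is the maximum degree of $G$. For $X\subseteq V(G)$, two vertices $a,b$ are $X$-visible if there is a shortest $a,b$-path $P$ in $G$ with $V(P)\cap X\subseteq\{a,b\}$. A set $X$ is a mutual-visibility set if every two vertices of $X$ are $X$-visible; it is maximal if no proper superset is a mutual-visibility set. $\mu^{ - }(G)$ is the minimum cardinality of a maximal mutual-visibility set of $G$. -}

module Defs where

open import Data.Nat using (ℕ; zero; suc; _<_; _≤_; _⊔_; _+_)
open import Data.Fin using (Fin)
open import Data.Fin.Subset using (Subset; _∈_; _⊂_)
open import Data.Bool using (Bool; true; false)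
open import Data.List using (List; []; _∷_; length; filter; map; foldr; allFin)
open import Data.List.Relation.Unary.All using (All)
open import Data.Product using (Σ; _×_; _,_)
open import Data.Sum using (_⊎_)
open import Relation.Binary.PropositionalEquality using (_≡_)
open import Relation.Nullary using (¬_)
open import Data.Bool using (T)

record Graph : Set where
  field
    n      : ℕ
    adj    : Fin n → Fin n → Bool
    sym    : ∀ u v → adj u v ≡ adj v u
    irrefl : ∀ v → adj v v ≡ false

open Graph public

module _ (G : Graph) where

  Vertex : Set
  Vertex = Fin (n G)

  Adj : Vertex → Vertex → Set
  Adj u v = adj G u v ≡ true

  data Walk : Vertex → Vertex → Set where
    [_]  : (v : Vertex) → Walk v v
    step : (u : Vertex) {v w : Vertex} → Adj u v → Walk v w → Walk u w

  len : ∀ {a b} → Walk a b → ℕ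
  len [ v ]          = 0
  len (step u _ w)   = suc (len w)

  verts : ∀ {a b} → Walk a b → List Vertex
  verts [ v ]        = v ∷ []
  verts (step u _ w) = u ∷ verts w

  -- A shortest a,b-path: an a,b-walk of minimum length
  -- (a minimum-length walk is necessarily a path).
  IsShortest : ∀ {a b} → Walk a b → Set
  IsShortest {a} {b} P = (Q : Walk a b) → len P ≤ len Q

  Visible : Subset (n G) → Vertex → Vertex → Set
  Visible X a b =
    Σ (Walk a b) λ P → IsShortest P ×
      All (λ v → v ∈ X → (v ≡ a ⊎ v ≡ b)) (verts P)

  MutualVisibility : Subset (n G) → Set
  MutualVisibility X = ∀ a b → a ∈ X → b ∈ X → Visible X a b

  MaximalMutualVisibility : Subset (n G) → Set
  MaximalMutualVisibility X =
    MutualVisibility X × (∀ Y → X ⊂ Y → ¬ MutualVisibility Y)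

  degree : Vertex → ℕ
  degree v = length (filter (λ u → Data.Bool._≟_ (adj G v u) true) (allFin (n G)))

  maxDegree : ℕ
  maxDegree = foldr _⊔_ 0 (map degree (allFin (n G)))

  HasInducedP4 : Set
  HasInducedP4 =
    Σ Vertex λ a → Σ Vertex λ b → Σ Vertex λ c → Σ Vertex λ d →
      ¬ a ≡ b × ¬ a ≡ c × ¬ a ≡ d × ¬ b ≡ c × ¬ b ≡ d × ¬ c ≡ d ×
      Adj a b × Adj b c × Adj c d ×
      adj G a c ≡ false × adj G b d ≡ false × adj G a d ≡ false

  IsCograph : Set
  IsCograph = ¬ HasInducedP4

-- For a vertex x of minimum degree, the closed neighbourhood N[x], of size deg x + 1 ≤ Δ + 1,
-- is a maximal mutual-visibility set. Maximality holds in every graph: a path from x to a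
-- vertex w ∉ N[x] passes through a neighbour of x, which lies in any superset of N[x].
-- For visibility, take non-adjacent a, b ∈ N(x). If N(a) ⊆ N[x], then N[a] ⊊ N[x] (b is
-- missing) and deg a < deg x; so a has a neighbour c ∉ N[x], and since c - a - x - b is not
-- an induced P₄, c is adjacent to b, giving the shortest path a - c - b avoiding N[x].
module Submission where

open import Defs
open import Data.Nat using (ℕ; _≤_; _+_; suc; _<_; _⊔_; z≤n; s≤s)
open import Data.Nat.Properties using (≤-trans; m≤m⊔n; m≤n⇒m≤o⊔n; +-comm; <⇒≱; ≤-pred)
open import Data.Fin using (Fin; zero; suc; fromℕ<; _≟_)
open import Data.Fin.Properties using (any?)
open import Data.Fin.Subset using (Subset; ∣_∣; _∈_; _∉_; _⊆_; ⁅_⁆; _∪_; inside; outside)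
open import Data.Fin.Subset.Properties
  using (_∈?_; x∈⁅x⁆; x∈⁅y⁆⇒x≡y; x∈p∪q⁺; x∈p∪q⁻; ∪-identityˡ; p⊂q⇒∣p∣<∣q∣)
open import Data.Bool using (Bool; true; false)
import Data.Bool as Bool
open import Data.Bool.Properties using (¬-not)
import Data.Vec as Vec
open import Data.Vec using (_∷_; here; there)
open import Data.Vec.Properties using (lookup∘tabulate; []=⇒lookup; lookup⇒[]=)
open import Data.List using (length; filter; foldr; allFin)
import Data.List as List
open import Data.List.Relation.Unary.All using (All; []; _∷_)
import Data.List.Relation.Unary.All as All
import Data.List.Relation.Unary.Any as Any
import Data.List.Membership.Propositional as ListMembership
open import Data.List.Membership.Propositional.Properties using (∈-map⁺; ∈-allFin)
open import Data.List.Extrema.Nat using (argmin; f[argmin]≤f[xs])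
open import Data.Product using (Σ; _×_; _,_; ∃)
open import Data.Sum using (_⊎_; inj₁; inj₂)
open import Function using (_∘_)
open import Relation.Nullary using (¬_; Dec; yes; no; _×-dec_; ¬?; contradiction)
open import Relation.Binary.PropositionalEquality using (_≡_; _≢_; refl; trans; cong; subst₂)
  renaming (sym to ≡-sym)

∣⁅x⁆∪p∣≡1+∣p∣ : ∀ {n} (x : Fin n) (p : Subset n) → x ∉ p → ∣ ⁅ x ⁆ ∪ p ∣ ≡ suc ∣ p ∣
∣⁅x⁆∪p∣≡1+∣p∣ zero    (inside  ∷ p) x∉p = contradiction here x∉p
∣⁅x⁆∪p∣≡1+∣p∣ zero    (outside ∷ p) x∉p = cong (suc ∘ ∣_∣) (∪-identityˡ p)
∣⁅x⁆∪p∣≡1+∣p∣ (suc x) (inside  ∷ p) x∉p = cong suc (∣⁅x⁆∪p∣≡1+∣p∣ x p (x∉p ∘ there))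
∣⁅x⁆∪p∣≡1+∣p∣ (suc x) (outside ∷ p) x∉p = ∣⁅x⁆∪p∣≡1+∣p∣ x p (x∉p ∘ there)

∣tabulate[f∘h]∣≡∣filter[f]∣ : ∀ {m k} (f : Fin k → Bool) (h : Fin m → Fin k) →
  ∣ Vec.tabulate (f ∘ h) ∣ ≡ length (filter (λ u → f u Bool.≟ true) (List.tabulate h))
∣tabulate[f∘h]∣≡∣filter[f]∣ {m = ℕ.zero} f h = refl
∣tabulate[f∘h]∣≡∣filter[f]∣ {m = suc m}  f h with f (h zero)
... | true  = cong suc (∣tabulate[f∘h]∣≡∣filter[f]∣ f (h ∘ suc))
... | false = ∣tabulate[f∘h]∣≡∣filter[f]∣ f (h ∘ suc)

∈⇒≤foldr-⊔ : ∀ {x xs} → x ListMembership.∈ xs → x ≤ foldr _⊔_ 0 xs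
∈⇒≤foldr-⊔ (Any.here refl) = m≤m⊔n _ _
∈⇒≤foldr-⊔ (Any.there x∈xs) = m≤n⇒m≤o⊔n _ (∈⇒≤foldr-⊔ x∈xs)

minimiser : ∀ {n} (f : Fin n → ℕ) → Fin n → ∃ λ x → ∀ y → f x ≤ f y
minimiser {n} f v =
  argmin f v (allFin n) , λ y → All.lookup (f[argmin]≤f[xs] v (allFin n)) (∈-allFin y)

module _ (G : Graph) where

  Adj-sym : ∀ {u v} → Adj G u v → Adj G v u
  Adj-sym {u} {v} uv = trans (sym G v u) uv

  Adj⇒≢ : ∀ {u v} → Adj G u v → u ≢ v
  Adj⇒≢ {u} uv refl = contradiction (trans (≡-sym uv) (irrefl G u)) λ ()

  Adj? : ∀ u v → Dec (Adj G u v)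
  Adj? u v = adj G u v Bool.≟ true

  cograph-closes-P₄ : IsCograph G → ∀ {a b c d} → Adj G a b → Adj G b c → Adj G c d →
    ¬ Adj G a c → ¬ Adj G b d → a ≢ c → b ≢ d → Adj G a d
  cograph-closes-P₄ cograph {a} {b} {c} {d} ab bc cd a≁c b≁d a≢c b≢d with Adj? a d
  ... | yes ad  = ad
  ... | no  a≁d = contradiction
    (a , b , c , d , Adj⇒≢ ab , a≢c , a≢d , Adj⇒≢ bc , b≢d , Adj⇒≢ cd ,
     ab , bc , cd , ¬-not a≁c , ¬-not b≁d , ¬-not a≁d)
    cograph
    where
    a≢d : a ≢ d
    a≢d refl = a≁c (Adj-sym cd)

  N : Vertex G → Subset (n G)
  N v = Vec.tabulate (adj G v)

  N[_] : Vertex G → Subset (n G)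
  N[ v ] = ⁅ v ⁆ ∪ N v

  ∈N⁺ : ∀ {u v} → Adj G v u → u ∈ N v
  ∈N⁺ {u} {v} vu = lookup⇒[]= u (N v) (trans (lookup∘tabulate (adj G v) u) vu)

  ∈N⁻ : ∀ {u v} → u ∈ N v → Adj G v u
  ∈N⁻ {u} {v} u∈Nv = trans (≡-sym (lookup∘tabulate (adj G v) u)) ([]=⇒lookup u∈Nv)

  ∈N[]⁺ : ∀ {u v} → u ≡ v ⊎ Adj G v u → u ∈ N[ v ]
  ∈N[]⁺ (inj₁ refl) = x∈p∪q⁺ (inj₁ (x∈⁅x⁆ _))
  ∈N[]⁺ (inj₂ vu)   = x∈p∪q⁺ (inj₂ (∈N⁺ vu))

  ∈N[]⁻ : ∀ {u v} → u ∈ N[ v ] → u ≡ v ⊎ Adj G v u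
  ∈N[]⁻ {u} {v} u∈N[v] with x∈p∪q⁻ ⁅ v ⁆ (N v) u∈N[v]
  ... | inj₁ u∈⁅v⁆ = inj₁ (x∈⁅y⁆⇒x≡y v u∈⁅v⁆)
  ... | inj₂ u∈Nv  = inj₂ (∈N⁻ u∈Nv)

  degree≡∣N∣ : ∀ v → degree G v ≡ ∣ N v ∣
  degree≡∣N∣ v = ≡-sym (∣tabulate[f∘h]∣≡∣filter[f]∣ (adj G v) (λ u → u))

  ∣N[]∣≡1+degree : ∀ v → ∣ N[ v ] ∣ ≡ suc (degree G v)
  ∣N[]∣≡1+degree v =
    trans (∣⁅x⁆∪p∣≡1+∣p∣ v (N v) (λ v∈Nv → Adj⇒≢ (∈N⁻ v∈Nv) refl)) (cong suc (≡-sym (degree≡∣N∣ v)))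

  degree≤maxDegree : ∀ v → degree G v ≤ maxDegree G
  degree≤maxDegree v = ∈⇒≤foldr-⊔ (∈-map⁺ (degree G) (∈-allFin v))

  visible-refl : ∀ X a → Visible G X a a
  visible-refl X a = [ a ] , (λ _ → z≤n) , (λ _ → inj₁ refl) ∷ []

  visible-adjacent : ∀ X {a b} → Adj G a b → Visible G X a b
  visible-adjacent X {a} {b} ab =
    step a ab [ b ] , nonempty , (λ _ → inj₁ refl) ∷ (λ _ → inj₂ refl) ∷ []
    where
    nonempty : (Q : Walk G a b) → 1 ≤ len G Q
    nonempty [ _ ]        = contradiction refl (Adj⇒≢ ab)
    nonempty (step _ _ _) = s≤s z≤n

  visible-via-common-neighbour : ∀ X {a b c} → a ≢ b → ¬ Adj G a b →
    Adj G a c → Adj G c b → c ∉ X → Visible G X a b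
  visible-via-common-neighbour X {a} {b} {c} a≢b a≁b ac cb c∉X =
    step a ac (step c cb [ b ]) , atLeastTwo ,
    (λ _ → inj₁ refl) ∷ (λ c∈X → contradiction c∈X c∉X) ∷ (λ _ → inj₂ refl) ∷ []
    where
    atLeastTwo : (Q : Walk G a b) → 2 ≤ len G Q
    atLeastTwo [ _ ]                   = contradiction refl a≢b
    atLeastTwo (step _ ab [ _ ])       = contradiction ab a≁b
    atLeastTwo (step _ _ (step _ _ _)) = s≤s (s≤s z≤n)

  All-verts-start : ∀ {P : Vertex G → Set} {u w} (R : Walk G u w) → All P (verts G R) → P u
  All-verts-start [ _ ]        (p ∷ _) = p
  All-verts-start (step _ _ _) (p ∷ _) = p

  -- Only the second vertex of the walk matters.
  ¬visible-outside-N[] : ∀ {x w} Y → N[ x ] ⊆ Y → w ∉ N[ x ] → ¬ Visible G Y x w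
  ¬visible-outside-N[] Y _    w∉N[x] ([ _ ] , _) = w∉N[x] (∈N[]⁺ (inj₁ refl))
  ¬visible-outside-N[] {x} Y N[x]⊆Y w∉N[x] (step _ {v} xv R , _ , _ ∷ avoidsY)
    with All-verts-start R avoidsY (N[x]⊆Y (∈N[]⁺ (inj₂ xv)))
  ... | inj₁ refl = Adj⇒≢ xv refl
  ... | inj₂ refl = w∉N[x] (∈N[]⁺ (inj₂ xv))

  N[]-maximal : ∀ x → MutualVisibility G N[ x ] → MaximalMutualVisibility G N[ x ]
  N[]-maximal x mv = mv , λ { Y (N[x]⊆Y , w , w∈Y , w∉N[x]) mvY →
    ¬visible-outside-N[] Y N[x]⊆Y w∉N[x] (mvY x w (N[x]⊆Y (∈N[]⁺ (inj₁ refl))) w∈Y) }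

  module _ {x : Vertex G} (minimum : ∀ y → degree G x ≤ degree G y) where

    ∃-neighbour-outside-N[] : ∀ {a b} → Adj G x a → b ∈ N[ x ] → a ≢ b → ¬ Adj G a b →
      ∃ λ c → Adj G a c × c ∉ N[ x ]
    ∃-neighbour-outside-N[] {a} {b} xa b∈N[x] a≢b a≁b
      with any? (λ c → Adj? a c ×-dec ¬? (c ∈? N[ x ]))
    ... | yes escape = escape
    ... | no ¬escape = contradiction (minimum a) (<⇒≱ degree-a<degree-x)
      where
      N[a]⊆N[x] : N[ a ] ⊆ N[ x ]
      N[a]⊆N[x] {u} u∈N[a] with ∈N[]⁻ u∈N[a] | u ∈? N[ x ]
      ... | inj₁ refl | _          = ∈N[]⁺ (inj₂ xa)
      ... | inj₂ _    | yes u∈N[x] = u∈N[x]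
      ... | inj₂ au   | no u∉N[x]  = contradiction (u , au , u∉N[x]) ¬escape

      b∉N[a] : b ∉ N[ a ]
      b∉N[a] b∈N[a] with ∈N[]⁻ b∈N[a]
      ... | inj₁ refl = a≢b refl
      ... | inj₂ ab   = a≁b ab

      degree-a<degree-x : degree G a < degree G x
      degree-a<degree-x = ≤-pred (subst₂ _<_ (∣N[]∣≡1+degree a) (∣N[]∣≡1+degree x)
        (p⊂q⇒∣p∣<∣q∣ (N[a]⊆N[x] , b , b∈N[x] , b∉N[a])))

    N[]-mutual : IsCograph G → MutualVisibility G N[ x ]
    N[]-mutual cograph a b a∈N[x] b∈N[x] with a ≟ b | Adj? a b
    ... | yes refl | _      = visible-refl N[ x ] a
    ... | no _     | yes ab = visible-adjacent N[ x ] ab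
    ... | no a≢b   | no a≁b =
      let xa = adjacent-to-x a∈N[x] b∈N[x] a≢b a≁b
          xb = adjacent-to-x b∈N[x] a∈N[x] (a≢b ∘ ≡-sym) (a≁b ∘ Adj-sym)
          c , ac , c∉N[x] = ∃-neighbour-outside-N[] xa b∈N[x] a≢b a≁b
          cb = cograph-closes-P₄ cograph (Adj-sym ac) (Adj-sym xa) xb
                 (λ cx → c∉N[x] (∈N[]⁺ (inj₂ (Adj-sym cx)))) a≁b
                 (c∉N[x] ∘ ∈N[]⁺ ∘ inj₁) a≢b
      in visible-via-common-neighbour N[ x ] a≢b a≁b ac cb c∉N[x]
      where
      adjacent-to-x : ∀ {u v} → u ∈ N[ x ] → v ∈ N[ x ] → u ≢ v → ¬ Adj G u v → Adj G x u
      adjacent-to-x u∈N[x] v∈N[x] u≢v u≁v with ∈N[]⁻ u∈N[x] | ∈N[]⁻ v∈N[x]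
      ... | inj₂ xu   | _         = xu
      ... | inj₁ refl | inj₁ refl = contradiction refl u≢v
      ... | inj₁ refl | inj₂ xv   = contradiction xv u≁v

corollary2p3 : (G : Graph) → IsCograph G → 2 ≤ n G →
    Σ (Subset (n G)) λ X →
    MaximalMutualVisibility G X × ∣ X ∣ ≤ maxDegree G + 1
corollary2p3 G cograph 2≤n =
  let x , minimum = minimiser (degree G) (fromℕ< (≤-trans (s≤s z≤n) 2≤n))
  in N[ G ] x , N[]-maximal G x (N[]-mutual G minimum cograph) ,
     subst₂ _≤_ (≡-sym (∣N[]∣≡1+degree G x)) (+-comm 1 (maxDegree G)) (s≤s (degree≤maxDegree G x))
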